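{- Let $\mathcal Y'=(\Omega',\{S'_0,\dots,S'_4\})$ be an association scheme algebraically isomorphic to the scheme $\mathcal Y=(\Omega,\{S_0,\dots,S_4\})$ defined in the context (for a generalized quadrangle of order $(s,s)$), with $S'_i$ corresponding to $S_i$. Let $C=\{x_0,x_1,\dots,x_s\}$ be a maximal clique of the graph $(\Omega',S'_1)$, and for each $i$ let $C'_i$ be the maximal clique of $(\Omega',S'_1)$ containing $x_i$ and different from $C$. Then the cliques $C'_0,C'_1,\dots,C'_s$ are pairwise disjoint.
   Context: A finite generalized quadrangle of order $(s,s)$ is an incidence structure of points and lines in which each point is on $s+1$ lines, each line has $s+1$ points, two distinct points lie on at most one common line, two distinct lines share at most one point, and for every non-incident point $p$ and line $L$ there is a unique pair $(q,M)$ with $p\,\mathrm I\,M\,\mathrm I\,q\,\mathrm I\,L$. $\Omega$ is its set of flags (incident pairs $(p,L)$). For flags $(p,L),(q,M)$ define: $R_1$: $p=q$, $L\ne M$; $R_2$: $L=M$, $p\ne q$; $R_3$: $p\ne q$ collinear on $L$, $M\ne L$; $R_4$: $p\neq q$ collinear on $M$, $L\neq M$; $R_5$: $p\ne q$ collinear on a line different from $L$ and $M$; $R_6$: $L\ne M$ meet in a point $r\ne p,q$; $R_7$: $L,M$ disjoint and $p,q$ not collinear. $\mathcal Y$ has relations $S_0=$ diagonal, $S_1=R_1\cup R_2$, $S_2=R_3\cup R_4$, $S_3=R_5\cup R_6$, $S_4=R_7$; it is an association scheme with intersection numbers $p^k_{ij}$. An algebraic isomorphism is a bijection $S_i\mapsto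 S'_i$ of basis relations preserving all intersection numbers. In $\mathcal Y'$ every vertex lies in exactly two maximal cliques of $(\Omega',S'_1)$, each of size $s+1$. -}

module Defs where

open import Data.Nat using (ℕ; zero; suc; _+_)
open import Data.Bool using (Bool; true; false; _∧_; _∨_; not; if_then_else_)
open import Data.Fin using (Fin; zero; suc; _≟_)
open import Data.Fin.Subset using (Subset; _∈_; _⊆_)
open import Data.Product using (Σ; _×_; _,_; ∃; ∃-syntax)
open import Relation.Nullary using (¬_)
open import Relation.Nullary.Decidable using (⌊_⌋)
open import Relation.Binary.PropositionalEquality using (_≡_; _≢_)

eqF : ∀ {n} → Fin n → Fin n → Bool
eqF a b = ⌊ a ≟ b ⌋

sumF : ∀ n → (Fin n → ℕ) → ℕ
sumF zero    f = 0
sumF (suc n) f = f zero + sumF n (λ i → f (suc i))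

countF : ∀ n → (Fin n → Bool) → ℕ
countF n P = sumF n (λ i → if P i then 1 else 0)

anyF : ∀ n → (Fin n → Bool) → Bool
anyF zero    P = false
anyF (suc n) P = P zero ∨ anyF n (λ i → P (suc i))

-- Finite generalized quadrangle of order (s,s)
-- points Fin P, lines Fin L, incidence inc p l = true

record IsGQ (s P L : ℕ) (inc : Fin P → Fin L → Bool) : Set where
  field
    linesPerPoint : ∀ p → countF L (λ l → inc p l) ≡ suc s
    pointsPerLine : ∀ l → countF P (λ p → inc p l) ≡ suc s
    pointsOneLine : ∀ p q → p ≢ q → ∀ l m →
      inc p l ≡ true → inc q l ≡ true → inc p m ≡ true → inc q m ≡ true → l ≡ m
    linesOnePoint : ∀ l m → l ≢ m → ∀ p q →
      inc p l ≡ true → inc p m ≡ true → inc q l ≡ true → inc q m ≡ true → p ≡ q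
    gqAxiom : ∀ p l → inc p l ≡ false →
      Σ (Fin P × Fin L) λ { (q , m) →
        (inc p m ≡ true × inc q m ≡ true × inc q l ≡ true) ×
        (∀ q' m' → inc p m' ≡ true → inc q' m' ≡ true → inc q' l ≡ true →
           (q' ≡ q × m' ≡ m)) }

-- The relations R₁,…,R₇ and S₀,…,S₄ on flags (p,L),(q,M).
-- A flag is a pair (p , L) with inc p L = true; relations are given as
-- boolean functions of the underlying point/line pairs.

module FlagRelations {P L : ℕ} (inc : Fin P → Fin L → Bool) where

  R₁ R₂ R₃ R₄ R₅ R₆ R₇ : Fin P → Fin L → Fin P → Fin L → Bool
  R₁ p l q m = eqF p q ∧ not (eqF l m)
  R₂ p l q m = eqF l m ∧ not (eqF p q)
  R₃ p l q m = not (eqF p q) ∧ inc q l ∧ not (eqF m l)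
  R₄ p l q m = not (eqF p q) ∧ inc p m ∧ not (eqF l m)
  R₅ p l q m = not (eqF p q) ∧
    anyF L (λ n → inc p n ∧ inc q n ∧ not (eqF n l) ∧ not (eqF n m))
  R₆ p l q m = not (eqF l m) ∧
    anyF P (λ r → inc r l ∧ inc r m ∧ not (eqF r p) ∧ not (eqF r q))
  R₇ p l q m = not (anyF P (λ r → inc r l ∧ inc r m)) ∧
               not (anyF L (λ n → inc p n ∧ inc q n))

  S : Fin 5 → Fin P → Fin L → Fin P → Fin L → Bool
  S zero                            p l q m = eqF p q ∧ eqF l m
  S (suc zero)                      p l q m = R₁ p l q m ∨ R₂ p l q m
  S (suc (suc zero))                p l q m = R₃ p l q m ∨ R₄ p l q m
  S (suc (suc (suc zero)))          p l q m = R₅ p l q m ∨ R₆ p l q m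
  S (suc (suc (suc (suc zero))))    p l q m = R₇ p l q m

  -- p^{(S_k)}_{ij} measured at the pair of flags ((p,L),(q,M)):
  -- number of flags (r,N) with (p,L) S_i (r,N) and (r,N) S_j (q,M)
  interY : Fin 5 → Fin 5 → Fin P → Fin L → Fin P → Fin L → ℕ
  interY i j p l q m =
    sumF P (λ r → countF L (λ n → inc r n ∧ S i p l r n ∧ S j r n q m))

-- Association schemes with basis relations S'_0,…,S'_4 on the vertex set
-- Fin n, given by rel x y = the index k with (x,y) ∈ S'_k.

inter : ∀ {n} → (Fin n → Fin n → Fin 5) → Fin 5 → Fin 5 → Fin n → Fin n → ℕ
inter {n} rel i j x y = countF n (λ z → eqF (rel x z) i ∧ eqF (rel z y) j)

record IsAssocScheme (n : ℕ) (rel : Fin n → Fin n → Fin 5) : Set where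
  field
    diag→ : ∀ x y → rel x y ≡ zero → x ≡ y
    diag← : ∀ x → rel x x ≡ zero
    nonempty : ∀ k → ∃[ x ] ∃[ y ] rel x y ≡ k
    transpose : Σ (Fin 5 → Fin 5) λ τ → ∀ x y → rel y x ≡ τ (rel x y)
    constant : ∀ i j x y x' y' → rel x y ≡ rel x' y' →
      inter rel i j x y ≡ inter rel i j x' y'

record IsAlgIsoToY {P L : ℕ} (inc : Fin P → Fin L → Bool)
                   (n : ℕ) (rel : Fin n → Fin n → Fin 5) : Set where
  open FlagRelations inc
  field
    nonemptyY : ∀ k → Σ (Fin P × Fin L × Fin P × Fin L) λ { (p , l , q , m) →
      inc p l ≡ true × inc q m ≡ true × S k p l q m ≡ true }
    sameInter : ∀ i j k p l q m → inc p l ≡ true → inc q m ≡ true →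
      S k p l q m ≡ true → ∀ x y → rel x y ≡ k →
      interY i j p l q m ≡ inter rel i j x y

IsClique : ∀ {n} → (Fin n → Fin n → Fin 5) → Subset n → Set
IsClique rel C = ∀ x y → x ∈ C → y ∈ C → x ≢ y → rel x y ≡ suc zero

IsMaxClique : ∀ {n} → (Fin n → Fin n → Fin 5) → Subset n → Set
IsMaxClique rel C = IsClique rel C × (∀ D → IsClique rel D → C ⊆ D → D ⊆ C)

{-# OPTIONS --safe #-}
module Submission where

-- Two flags (p,L), (p,M), L ≠ M, of a generalized quadrangle of order (s,s)
-- have exactly the s - 1 common S₁-neighbours (p,N), N ≠ L, M, and the
-- algebraic isomorphism transports this intersection number to 𝒴'.  A vertex
-- outside the (s+1)-clique C adjacent to two vertices x i ≠ x k of C would,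
-- with the s - 1 other vertices of C, give them s common neighbours; so a
-- vertex outside C is adjacent to at most one vertex of C.  A maximal clique
-- D ≠ C has a vertex outside C, hence meets C only once.  So a common vertex of
-- C'ᵢ and C'ⱼ (i ≠ j) can lie neither in C nor outside it.

open import Defs
open import Data.Nat using (ℕ; suc; zero; _+_; _≤_; z≤n; s≤s)
open import Data.Nat.Properties using (+-identityʳ; +-suc; ≤-trans; ≤-reflexive; n≮n)
  renaming (suc-injective to ℕ-suc-injective)
open import Data.Bool using (Bool; true; false; _∧_; not; if_then_else_)
open import Data.Bool.Properties using (∧-zeroʳ; ∧-identityʳ; ¬-not)
  renaming (_≟_ to _≟ᵇ_)
open import Data.Fin using (Fin; zero; suc; _≟_; punchIn)
open import Data.Fin.Properties
  using (suc-injective; 0≢1+n; any?; ¬∀⟶∃¬; punchIn-injective; punchInᵢ≢i)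
open import Data.Fin.Subset using (Subset; _∈_; _∉_)
open import Data.Fin.Subset.Properties using (_∈?_; _⊆?_; ⊆-antisym)
open import Data.Vec.Functional using (updateAt)
open import Data.Vec.Functional.Properties using (updateAt-updates; updateAt-minimal)
open import Data.Product using (∃; ∃-syntax; _×_; _,_)
open import Data.Sum using ([_,_]′)
open import Function using (_∘_; const)
open import Function.Definitions using (Injective)
open import Relation.Binary.PropositionalEquality
  using (_≡_; _≢_; refl; sym; trans; cong; cong₂; subst; module ≡-Reasoning)
open import Relation.Nullary using (¬_; yes; no; contradiction; _→-dec_)
open import Relation.Nullary.Decidable
  using (isYes≗does; dec-true; dec-false; decidable-stable; toSum)

open ≡-Reasoning

eqF-refl : ∀ {n} (a : Fin n) → eqF a a ≡ true
eqF-refl a = trans (isYes≗does (a ≟ a)) (dec-true (a ≟ a) refl)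

eqF-≢ : ∀ {n} {a b : Fin n} → a ≢ b → eqF a b ≡ false
eqF-≢ {a = a} {b} a≢b = trans (isYes≗does (a ≟ b)) (dec-false (a ≟ b) a≢b)

not-eqF⇒≢ : ∀ {n} {a b : Fin n} → not (eqF a b) ≡ true → a ≢ b
not-eqF⇒≢ {a = a} a≠b refl with () ← trans (sym (cong not (eqF-refl a))) a≠b

eqF∧eqF≡false : ∀ {n} {a c : Fin n} → a ≢ c → ∀ b → eqF a b ∧ eqF b c ≡ false
eqF∧eqF≡false {a = a} a≢c b with a ≟ b
... | yes refl = eqF-≢ a≢c
... | no _     = refl

∧≡true : ∀ {x y} → x ∧ y ≡ true → x ≡ true × y ≡ true
∧≡true {true} {true} _ = refl , refl

sumF-zero : ∀ n {f : Fin n → ℕ} → (∀ k → f k ≡ 0) → sumF n f ≡ 0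
sumF-zero zero    _   = refl
sumF-zero (suc n) f≡0 rewrite f≡0 zero = sumF-zero n (f≡0 ∘ suc)

sumF-single : ∀ n {f : Fin n → ℕ} (a : Fin n) → (∀ k → k ≢ a → f k ≡ 0) →
  sumF n f ≡ f a
sumF-single (suc n) {f} zero f≡0 =
  trans (cong (f zero +_) (sumF-zero n (λ k → f≡0 (suc k) λ ()))) (+-identityʳ (f zero))
sumF-single (suc n) (suc a) f≡0 rewrite f≡0 zero (λ ()) =
  sumF-single n a (λ k k≢a → f≡0 (suc k) (k≢a ∘ suc-injective))

countF-cong : ∀ n {P Q : Fin n → Bool} → (∀ k → P k ≡ Q k) → countF n P ≡ countF n Q
countF-cong zero    _   = refl
countF-cong (suc n) P≗Q rewrite P≗Q zero = cong (_ +_) (countF-cong n (P≗Q ∘ suc))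

countF-false : ∀ n {P : Fin n → Bool} → (∀ k → P k ≡ false) → countF n P ≡ 0
countF-false n P≡false = sumF-zero n (λ k → cong (λ b → if b then 1 else 0) (P≡false k))

countF-witness : ∀ n {P : Fin n → Bool} {c} → countF n P ≡ suc c → ∃ λ k → P k ≡ true
countF-witness n {P} count≡suc with any? (λ k → P k ≟ᵇ true)
... | yes witness = witness
... | no none = contradiction (trans (sym count≡suc) (countF-false n all-false)) λ ()
  where
  all-false : ∀ k → P k ≡ false
  all-false k = ¬-not (λ Pk → none (k , Pk))

countF-remove : ∀ {n} {P Q : Fin n → Bool} (a : Fin n) → P a ≡ true → Q a ≡ false →
  (∀ k → k ≢ a → Q k ≡ P k) → countF n P ≡ suc (countF n Q)
countF-remove {suc n} zero Pa Qa Q≗P rewrite Pa | Qa =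
  cong suc (sym (countF-cong n (λ k → Q≗P (suc k) λ ())))
countF-remove {suc n} {P} {Q} (suc a) Pa Qa Q≗P rewrite Q≗P zero (λ ()) =
  trans (cong (P₀ +_) (countF-remove {P = P ∘ suc} {Q ∘ suc} a Pa Qa Q≗P-tail))
        (+-suc P₀ _)
  where
  P₀ : ℕ
  P₀ = if P zero then 1 else 0
  Q≗P-tail : ∀ k → k ≢ a → Q (suc k) ≡ P (suc k)
  Q≗P-tail k k≢a = Q≗P (suc k) (k≢a ∘ suc-injective)

countF-without : ∀ {n} {P : Fin n → Bool} {a : Fin n} → P a ≡ true →
  countF n P ≡ suc (countF n (λ k → P k ∧ not (eqF a k)))
countF-without {P = P} {a} Pa = countF-remove a Pa a-removed others-kept
  where
  a-removed : P a ∧ not (eqF a a) ≡ false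
  a-removed rewrite eqF-refl a = ∧-zeroʳ (P a)
  others-kept : ∀ k → k ≢ a → P k ∧ not (eqF a k) ≡ P k
  others-kept k k≢a rewrite eqF-≢ (k≢a ∘ sym) = ∧-identityʳ (P k)

countF-≥-injection : ∀ {m n} {P : Fin n → Bool} (f : Fin m → Fin n) →
  Injective _≡_ _≡_ f → (∀ t → P (f t) ≡ true) → m ≤ countF n P
countF-≥-injection {zero}          _ _     _  = z≤n
countF-≥-injection {suc m} {n} {P} f f-inj Pf =
  subst (suc m ≤_) (sym (countF-without {P = P} (Pf zero)))
    (s≤s (countF-≥-injection (f ∘ suc) (suc-injective ∘ f-inj) Pf-rest))
  where
  Pf-rest : ∀ t → P (f (suc t)) ∧ not (eqF (f zero) (f (suc t))) ≡ true
  Pf-rest t rewrite Pf (suc t) | eqF-≢ (0≢1+n ∘ f-inj {zero} {suc t}) = refl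

updateAt-injective : ∀ {A : Set} {m} {xs : Fin m → A} {z : A} (i : Fin m) →
  Injective _≡_ _≡_ xs → (∀ t → z ≢ xs t) → Injective _≡_ _≡_ (updateAt xs i (const z))
updateAt-injective {xs = xs} i xs-inj z∉xs {a} {b} e with a ≟ i | b ≟ i
... | yes refl | yes refl = refl
... | yes refl | no b≢i   = contradiction
  (trans (sym (updateAt-updates i xs)) (trans e (updateAt-minimal b i xs b≢i))) (z∉xs b)
... | no a≢i   | yes refl = contradiction
  (trans (sym (updateAt-updates i xs)) (trans (sym e) (updateAt-minimal a i xs a≢i))) (z∉xs a)
... | no a≢i   | no b≢i   =
  xs-inj (trans (sym (updateAt-minimal a i xs a≢i)) (trans e (updateAt-minimal b i xs b≢i)))

module _ {P L : ℕ} (inc : Fin P → Fin L → Bool) where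
  open FlagRelations inc

  S₁-samePoint : ∀ p l m → S (suc zero) p l p m ≡ not (eqF l m)
  S₁-samePoint p l m rewrite eqF-refl p with eqF l m
  ... | true  = refl
  ... | false = refl

  S₁-distinctPoints : ∀ {p q} → p ≢ q → ∀ l m → S (suc zero) p l q m ≡ eqF l m
  S₁-distinctPoints p≢q l m rewrite eqF-≢ p≢q = ∧-identityʳ (eqF l m)

module _ {s P L : ℕ} {inc : Fin P → Fin L → Bool} (gq : IsGQ s P L inc) where
  open FlagRelations inc
  open IsGQ gq

  otherLines-count : ∀ {p l} → inc p l ≡ true →
    countF L (λ k → inc p k ∧ not (eqF l k)) ≡ s
  otherLines-count {p} ipl =
    ℕ-suc-injective (trans (sym (countF-without {P = inc p} ipl)) (linesPerPoint p))

  interY₁₁-samePoint : ∀ {p l m} → inc p l ≡ true → inc p m ≡ true → l ≢ m →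
    suc (interY (suc zero) (suc zero) p l p m) ≡ s
  interY₁₁-samePoint {p} {l} {m} ipl ipm l≢m = begin
    suc (interY (suc zero) (suc zero) p l p m)
      ≡⟨ cong suc (sumF-single P p offPoint) ⟩
    suc (countF L (λ k → inc p k ∧ S (suc zero) p l p k ∧ S (suc zero) p k p m))
      ≡⟨ cong suc (countF-cong L atPoint) ⟩
    suc (countF L (λ k → inc p k ∧ not (eqF l k) ∧ not (eqF k m)))
      ≡⟨ sym (countF-remove m m-kept m-removed others-kept) ⟩
    countF L (λ k → inc p k ∧ not (eqF l k))
      ≡⟨ otherLines-count ipl ⟩
    s ∎
    where
    offPoint : ∀ r → r ≢ p →
      countF L (λ k → inc r k ∧ S (suc zero) p l r k ∧ S (suc zero) r k p m) ≡ 0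
    offPoint r r≢p = countF-false L λ k → begin
      inc r k ∧ S (suc zero) p l r k ∧ S (suc zero) r k p m
        ≡⟨ cong₂ (λ a b → inc r k ∧ a ∧ b)
                 (S₁-distinctPoints inc (r≢p ∘ sym) l k) (S₁-distinctPoints inc r≢p k m) ⟩
      inc r k ∧ eqF l k ∧ eqF k m
        ≡⟨ cong (inc r k ∧_) (eqF∧eqF≡false l≢m k) ⟩
      inc r k ∧ false
        ≡⟨ ∧-zeroʳ (inc r k) ⟩
      false ∎
    atPoint : ∀ k → inc p k ∧ S (suc zero) p l p k ∧ S (suc zero) p k p m
                  ≡ inc p k ∧ not (eqF l k) ∧ not (eqF k m)
    atPoint k =
      cong₂ (λ a b → inc p k ∧ a ∧ b) (S₁-samePoint inc p l k) (S₁-samePoint inc p k m)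
    m-kept : inc p m ∧ not (eqF l m) ≡ true
    m-kept rewrite ipm | eqF-≢ l≢m = refl
    m-removed : inc p m ∧ not (eqF l m) ∧ not (eqF m m) ≡ false
    m-removed rewrite eqF-refl m = trans (cong (inc p m ∧_) (∧-zeroʳ _)) (∧-zeroʳ (inc p m))
    others-kept : ∀ k → k ≢ m →
      inc p k ∧ not (eqF l k) ∧ not (eqF k m) ≡ inc p k ∧ not (eqF l k)
    others-kept k k≢m rewrite eqF-≢ k≢m = cong (inc p k ∧_) (∧-identityʳ _)

inter₁₁≡s : ∀ {s P L inc n rel} → IsGQ (suc s) P L inc → IsAlgIsoToY inc n rel →
  ∀ {a b} → rel a b ≡ suc zero → inter rel (suc zero) (suc zero) a b ≡ s
inter₁₁≡s {inc = inc} {rel = rel} gq iso {a} {b} a~b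
  with (p , l , _) , ipl , _ ← IsAlgIsoToY.nonemptyY iso zero
  with m , ipm∧l≠m ← countF-witness _ (otherLines-count gq ipl)
  with ipm , l≠m ← ∧≡true ipm∧l≠m = ℕ-suc-injective (begin
  suc (inter rel (suc zero) (suc zero) a b)
    ≡⟨ cong suc (sym (IsAlgIsoToY.sameInter iso (suc zero) (suc zero) (suc zero)
                        p l p m ipl ipm (trans (S₁-samePoint inc p l m) l≠m) a b a~b)) ⟩
  suc (interY (suc zero) (suc zero) p l p m)
    ≡⟨ interY₁₁-samePoint gq ipl ipm (not-eqF⇒≢ l≠m) ⟩
  suc _ ∎)
  where open FlagRelations inc

module _ {n : ℕ} (rel : Fin n → Fin n → Fin 5) where

  inter-member : ∀ {i j a b c} → rel a c ≡ i → rel c b ≡ j →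
    eqF (rel a c) i ∧ eqF (rel c b) j ≡ true
  inter-member {i} {j} refl refl rewrite eqF-refl i | eqF-refl j = refl

  inter₁₁-≥-clique : ∀ {s} (x : Fin (suc s) → Fin n) → Injective _≡_ _≡_ x →
    (∀ a b → a ≢ b → rel (x a) (x b) ≡ suc zero) →
    ∀ {i k z} → (∀ t → z ≢ x t) → rel (x i) z ≡ suc zero → rel z (x k) ≡ suc zero →
    s ≤ inter rel (suc zero) (suc zero) (x i) (x k)
  inter₁₁-≥-clique x x-inj x-adj {i} {k} {z} z∉x xi~z z~xk =
    countF-≥-injection (y ∘ punchIn k)
      (punchIn-injective k _ _ ∘ updateAt-injective i x-inj z∉x)
      (λ t → y-common (punchIn k t) (punchInᵢ≢i k t))
    where
    -- s common neighbours, indexed by Fin s: replace x i by z, then skip index k.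
    y : Fin (suc _) → Fin n
    y = updateAt x i (const z)
    y-common : ∀ u → u ≢ k →
      eqF (rel (x i) (y u)) (suc zero) ∧ eqF (rel (y u) (x k)) (suc zero) ≡ true
    y-common u u≢k with u ≟ i
    ... | yes refl rewrite updateAt-updates u {const z} x = inter-member xi~z z~xk
    ... | no u≢i   rewrite updateAt-minimal u i {const z} x u≢i =
      inter-member (x-adj i u (u≢i ∘ sym)) (x-adj u k u≢k)

outside-common-neighbour⇒≡ : ∀ {s P L inc n rel} →
  IsGQ s P L inc → IsAlgIsoToY inc n rel →
  {x : Fin (suc s) → Fin n} → Injective _≡_ _≡_ x →
  (∀ a b → a ≢ b → rel (x a) (x b) ≡ suc zero) →
  ∀ {z} → (∀ t → z ≢ x t) →
  ∀ {i k} → rel (x i) z ≡ suc zero → rel z (x k) ≡ suc zero → i ≡ k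
outside-common-neighbour⇒≡ {zero} _ _ _ _ _ {zero} {zero} _ _ = refl
outside-common-neighbour⇒≡ {suc s} {rel = rel} gq iso {x} x-inj x-adj z∉x {i} {k} xi~z z~xk
  with i ≟ k
... | yes i≡k = i≡k
... | no i≢k  = contradiction
  (≤-trans (inter₁₁-≥-clique rel x x-inj x-adj z∉x xi~z z~xk)
           (≤-reflexive (inter₁₁≡s gq iso (x-adj i k i≢k))))
  (n≮n s)

maxClique-⊈ : ∀ {n rel} {C D : Subset n} → IsClique rel C → IsMaxClique rel D → D ≢ C →
  ∃ λ d → d ∈ D × d ∉ C
maxClique-⊈ {n} {C = C} {D} C-clique (_ , D-max) D≢C with D ⊆? C
... | yes D⊆C = contradiction (⊆-antisym D⊆C (D-max C C-clique D⊆C)) D≢C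
... | no D⊈C
  with ¬∀⟶∃¬ n _ (λ d → d ∈? D →-dec d ∈? C) (λ D⊆C → D⊈C (D⊆C _))
... | d , d∈D⇏d∈C =
  d , decidable-stable (d ∈? D) (λ d∉D → d∈D⇏d∈C (λ d∈D → contradiction d∈D d∉D))
    , λ d∈C → d∈D⇏d∈C (const d∈C)

module CliqueC {s P L : ℕ} {inc : Fin P → Fin L → Bool} (gq : IsGQ s P L inc)
         {n : ℕ} {rel : Fin n → Fin n → Fin 5} (iso : IsAlgIsoToY inc n rel)
         {C : Subset n} (C-clique : IsClique rel C)
         {x : Fin (suc s) → Fin n} (x-inj : Injective _≡_ _≡_ x) (x∈C : ∀ i → x i ∈ C) where

  ∉C⇒≢x : ∀ {z} → z ∉ C → ∀ t → z ≢ x t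
  ∉C⇒≢x z∉C t refl = z∉C (x∈C t)

  x-adj : ∀ a b → a ≢ b → rel (x a) (x b) ≡ suc zero
  x-adj a b a≢b = C-clique (x a) (x b) (x∈C a) (x∈C b) (a≢b ∘ x-inj)

  ∉C-neighbour⇒≡ : ∀ {z} → z ∉ C →
    ∀ {i k} → rel (x i) z ≡ suc zero → rel z (x k) ≡ suc zero → i ≡ k
  ∉C-neighbour⇒≡ z∉C = outside-common-neighbour⇒≡ gq iso x-inj x-adj (∉C⇒≢x z∉C)

  otherMaxClique-meets-once : ∀ {D} → IsMaxClique rel D → D ≢ C →
    ∀ {i k} → x i ∈ D → x k ∈ D → i ≡ k
  otherMaxClique-meets-once maxD@(D-clique , _) D≢C {i} {k} xi∈D xk∈D
    with d , d∈D , d∉C ← maxClique-⊈ C-clique maxD D≢C = ∉C-neighbour⇒≡ d∉C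
      (D-clique (x i) d xi∈D d∈D (∉C⇒≢x d∉C i ∘ sym))
      (D-clique d (x k) d∈D xk∈D (∉C⇒≢x d∉C k))

mainTheorem12 : (s P L : ℕ) (inc : Fin P → Fin L → Bool) → IsGQ s P L inc →
  (n : ℕ) (rel : Fin n → Fin n → Fin 5) → IsAssocScheme n rel →
  IsAlgIsoToY inc n rel →
  (C : Subset n) → IsMaxClique rel C →
  (x : Fin (suc s) → Fin n) → Injective _≡_ _≡_ x →
  (∀ v → v ∈ C → ∃[ i ] x i ≡ v) → (∀ i → x i ∈ C) →
  ∀ i j → i ≢ j →
  ∀ (D D' : Subset n) → IsMaxClique rel D → IsMaxClique rel D' →
  D ≢ C → D' ≢ C → x i ∈ D → x j ∈ D' →
  ∀ v → ¬ (v ∈ D × v ∈ D')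
mainTheorem12 s P L inc gq n rel _ iso C (C-clique , _) x x-inj x-onto x∈C i j i≢j D D'
  maxD@(D-clique , _) maxD'@(D'-clique , _) D≢C D'≢C xi∈D xj∈D' v (v∈D , v∈D') =
  i≢j ([ inside , outside ]′ (toSum (v ∈? C)))
  where
  open CliqueC gq iso C-clique x-inj x∈C
  inside : v ∈ C → i ≡ j
  inside v∈C with k , refl ← x-onto v v∈C =
    trans (otherMaxClique-meets-once maxD D≢C xi∈D v∈D)
          (sym (otherMaxClique-meets-once maxD' D'≢C xj∈D' v∈D'))
  outside : v ∉ C → i ≡ j
  outside v∉C = ∉C-neighbour⇒≡ v∉C
    (D-clique (x i) v xi∈D v∈D (∉C⇒≢x v∉C i ∘ sym))
    (D'-clique v (x j) v∈D' xj∈D' (∉C⇒≢x v∉C j))
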